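{- Let $G$ be a banner-free graph with a homogeneous set $H$. Then $G$ contains no odd hole if and only if both $G[H]$ and $G[(V(G)\setminus H)\cup\{h\}]$ contain no odd hole, for any vertex $h \in H$.
   Context: All graphs are finite and simple. A hole is an induced cycle $C_k$ with $k\ge 4$, odd if $k$ is odd. A banner is an induced $C_4$ plus one vertex adjacent to exactly one vertex of the $C_4$; banner-free means no induced banner. A set $H \subseteq V(G)$ is homogeneous if $2 \leq |H| < |V(G)|$ and every vertex outside $H$ is adjacent to all or to none of the vertices of $H$. -}

module Defs where

open import Data.Nat using (ℕ; _≤_; _≡ᵇ_; _*_) renaming (suc to sucℕ)
open import Data.Fin using (Fin; toℕ; _≟_)
open import Data.Bool using (Bool; true; false; T; not; _∨_; _∧_)
open import Data.Product using (Σ; _×_; _,_; proj₁; ∃-syntax)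
open import Data.Sum using (_⊎_)
open import Relation.Nullary using (¬_)
open import Relation.Nullary.Decidable using (⌊_⌋)
open import Relation.Binary.PropositionalEquality using (_≡_; _≢_)
open import Function.Definitions using (Injective)

record Graph (V : Set) : Set where
  field
    adj    : V → V → Bool
    sym    : ∀ u v → adj u v ≡ adj v u
    irrefl : ∀ v → adj v v ≡ false
open Graph public

Sub : {V : Set} → (V → Bool) → Set
Sub {V} S = Σ V (λ v → T (S v))

induced : {V : Set} → Graph V → (S : V → Bool) → Graph (Sub S)
induced G S = record
  { adj    = λ u v → adj G (proj₁ u) (proj₁ v)
  ; sym    = λ u v → sym G (proj₁ u) (proj₁ v)
  ; irrefl = λ v → irrefl G (proj₁ v)
  }

InducedCopy : {V : Set} → Graph V → (k : ℕ) → (Fin k → Fin k → Bool) → Set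
InducedCopy {V} G k P =
  Σ (Fin k → V) λ f → Injective _≡_ _≡_ f × (∀ i j → i ≢ j → adj G (f i) (f j) ≡ P i j)

-- Adjacency of the cycle C_k on vertices 0,1,…,k-1 (i ~ i+1 mod k).
consec : (k : ℕ) → Fin k → Fin k → Bool
consec k i j = (sucℕ (toℕ i) ≡ᵇ toℕ j) ∨ ((sucℕ (toℕ i) ≡ᵇ k) ∧ (toℕ j ≡ᵇ 0))

cycleAdj : (k : ℕ) → Fin k → Fin k → Bool
cycleAdj k i j = consec k i j ∨ consec k j i

Odd : ℕ → Set
Odd k = Σ ℕ λ m → k ≡ sucℕ (2 * m)

OddHole : {V : Set} → Graph V → Set
OddHole G = Σ ℕ λ k → (4 ≤ k) × Odd k × InducedCopy G k (cycleAdj k)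

bannerEdge : ℕ → ℕ → Bool
bannerEdge 0 1 = true
bannerEdge 1 2 = true
bannerEdge 2 3 = true
bannerEdge 0 3 = true
bannerEdge 0 4 = true
bannerEdge _ _ = false

bannerAdj : Fin 5 → Fin 5 → Bool
bannerAdj i j = bannerEdge (toℕ i) (toℕ j) ∨ bannerEdge (toℕ j) (toℕ i)

BannerFree : {V : Set} → Graph V → Set
BannerFree G = ¬ InducedCopy G 5 bannerAdj

-- Homogeneous set: 2 ≤ |H| < |V(G)|, and every vertex outside H is
-- adjacent to all or to none of H.
Homogeneous : {V : Set} → Graph V → (V → Bool) → Set
Homogeneous {V} G H =
  (Σ V λ a → Σ V λ b → a ≢ b × T (H a) × T (H b))
  × (Σ V λ v → T (not (H v)))
  × (∀ v → T (not (H v)) →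
       (∀ u → T (H u) → adj G v u ≡ true) ⊎ (∀ u → T (H u) → adj G v u ≡ false))

outsidePlus : {n : ℕ} → (Fin n → Bool) → Fin n → Fin n → Bool
outsidePlus H h v = not (H v) ∨ ⌊ v ≟ h ⌋

module Submission where

-- Both G[H] and
-- G[(V(G) \ H) ∪ {h}] are induced subgraphs of G, so an odd hole in either is
-- an odd hole of G.  Conversely, let C be an odd hole of G (length k ≥ 5):
--   * if C meets H in at most one vertex, replacing that vertex by h
--     ("collapsing H onto h") maps C onto an induced copy of C inside
--     G[(V(G) \ H) ∪ {h}], because outside vertices see h exactly as they
--     see any other vertex of H;
--   * if C meets H in two vertices, all of C lies in H: an outside vertex of C
--     adjacent to a vertex of H is complete to H, hence has both H-vertices as
--     its two cycle neighbours, and the vertex two steps further along C then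
--     yields a chord.  So membership in H propagates around C.

open import Defs hiding (sym)
open import Data.Nat using (ℕ; zero; suc; _+_; _*_; _∸_; _≤_; _<_; z≤n; s≤s)
open import Data.Nat.Properties
  using (+-comm; +-assoc; ≤-refl; ≤-trans; <⇒≤; m≤m+n; m≤n+m; m∸n+n≡m;
         m≤n⇒m<n∨m≡n; ≡ᵇ⇒≡; ≡⇒≡ᵇ)
open import Data.Nat.DivMod
  using (_%_; _/_; %-distribˡ-+; m%n%n≡m%n; m≡m%n+[m/n]*n; [m+kn]%n≡m%n;
         [m+n]%n≡m%n; m%n<n; m%n≤n; m<n⇒m%n≡m; n%n≡0)
open import Data.Nat.Solver using (module +-*-Solver)
open import Data.Fin using (Fin; toℕ; fromℕ<; _≟_)
open import Data.Fin.Properties using (toℕ-injective; toℕ<n; toℕ-fromℕ<; any?)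
open import Data.Bool using (Bool; true; false; T; not; if_then_else_)
open import Data.Bool.Properties using (T?; T-∨; T-∧; T-≡; T-not-≡; T-irrelevant)
open import Data.Empty using (⊥)
open import Data.Product using (Σ; _×_; _,_; proj₁)
open import Data.Sum using (_⊎_; inj₁; inj₂)
open import Relation.Nullary using (¬_; Dec; yes; no; ¬?; contradiction)
open import Relation.Nullary.Decidable using (fromWitness; _×-dec_)
open import Relation.Binary.PropositionalEquality
  using (_≡_; _≢_; refl; sym; trans; cong; cong₂; subst; module ≡-Reasoning)
open import Function.Bundles using (_⇔_; mk⇔; Equivalence)
open Equivalence using (to; from)
open ≡-Reasoning

module Cycle (K : ℕ) where

  k : ℕ
  k = suc K

  %-absorbʳ : ∀ a b → (a + b % k) % k ≡ (a + b) % k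
  %-absorbʳ a b = begin
    (a + b % k) % k         ≡⟨ %-distribˡ-+ a (b % k) k ⟩
    (a % k + b % k % k) % k ≡⟨ cong (λ t → (a % k + t) % k) (m%n%n≡m%n b k) ⟩
    (a % k + b % k) % k     ≡⟨ %-distribˡ-+ a b k ⟨
    (a + b) % k             ∎

  %-undo : ∀ c z → (k ∸ c % k + (c + z)) % k ≡ z % k
  %-undo c z = begin
    (k ∸ r + (c + z)) % k     ≡⟨ cong (λ t → (k ∸ r + (t + z)) % k) (m≡m%n+[m/n]*n c k) ⟩
    (k ∸ r + (r + q + z)) % k ≡⟨ cong (_% k) (rearrange (k ∸ r) r q z) ⟩
    (z + (k ∸ r + r + q)) % k ≡⟨ cong (λ t → (z + (t + q)) % k) (m∸n+n≡m (m%n≤n c k)) ⟩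
    (z + (k + q)) % k         ≡⟨ [m+kn]%n≡m%n z (suc (c / k)) k ⟩
    z % k                     ∎
    where
    open +-*-Solver
    r q : ℕ
    r = c % k
    q = (c / k) * k

    rearrange : ∀ s r q z → s + (r + q + z) ≡ z + (s + r + q)
    rearrange = solve 4 (λ s r q z → s :+ (r :+ q :+ z) := z :+ (s :+ r :+ q)) refl

  %-cancelˡ : ∀ c x y → (c + x) % k ≡ (c + y) % k → x % k ≡ y % k
  %-cancelˡ c x y e = begin
    x % k                         ≡⟨ %-undo c x ⟨
    (k ∸ c % k + (c + x)) % k     ≡⟨ %-absorbʳ (k ∸ c % k) (c + x) ⟨
    (k ∸ c % k + (c + x) % k) % k ≡⟨ cong (λ t → (k ∸ c % k + t) % k) e ⟩
    (k ∸ c % k + (c + y) % k) % k ≡⟨ %-absorbʳ (k ∸ c % k) (c + y) ⟩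
    (k ∸ c % k + (c + y)) % k     ≡⟨ %-undo c y ⟩
    y % k                         ∎

  shift : ℕ → Fin k → Fin k
  shift c i = fromℕ< (m%n<n (c + toℕ i) k)

  next : Fin k → Fin k
  next = shift 1

  toℕ-shift : ∀ c i → toℕ (shift c i) ≡ (c + toℕ i) % k
  toℕ-shift c i = toℕ-fromℕ< _

  toℕ%k : ∀ (i : Fin k) → toℕ i % k ≡ toℕ i
  toℕ%k i = m<n⇒m%n≡m (toℕ<n i)

  shift-zero : ∀ i → shift 0 i ≡ i
  shift-zero i = toℕ-injective (trans (toℕ-shift 0 i) (toℕ%k i))

  shift-shift : ∀ c d i → shift c (shift d i) ≡ shift (c + d) i
  shift-shift c d i = toℕ-injective (begin
    toℕ (shift c (shift d i)) ≡⟨ toℕ-shift c (shift d i) ⟩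
    (c + toℕ (shift d i)) % k ≡⟨ cong (λ t → (c + t) % k) (toℕ-shift d i) ⟩
    (c + (d + toℕ i) % k) % k ≡⟨ %-absorbʳ c (d + toℕ i) ⟩
    (c + (d + toℕ i)) % k     ≡⟨ cong (_% k) (+-assoc c d (toℕ i)) ⟨
    (c + d + toℕ i) % k       ≡⟨ toℕ-shift (c + d) i ⟨
    toℕ (shift (c + d) i)     ∎)

  next-shift : ∀ c i → next (shift c i) ≡ shift (suc c) i
  next-shift = shift-shift 1

  shift-injʳ : ∀ {c i j} → shift c i ≡ shift c j → i ≡ j
  shift-injʳ {c} {i} {j} e = toℕ-injective (begin
    toℕ i     ≡⟨ toℕ%k i ⟨
    toℕ i % k ≡⟨ %-cancelˡ c (toℕ i) (toℕ j)
                   (trans (sym (toℕ-shift c i)) (trans (cong toℕ e) (toℕ-shift c j))) ⟩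
    toℕ j % k ≡⟨ toℕ%k j ⟩
    toℕ j     ∎)

  shift-injˡ : ∀ {c d} i → c < k → d < k → shift c i ≡ shift d i → c ≡ d
  shift-injˡ {c} {d} i c<k d<k e = begin
    c     ≡⟨ m<n⇒m%n≡m c<k ⟨
    c % k ≡⟨ %-cancelˡ (toℕ i) c d (begin
               (toℕ i + c) % k     ≡⟨ cong (_% k) (+-comm (toℕ i) c) ⟩
               (c + toℕ i) % k     ≡⟨ toℕ-shift c i ⟨
               toℕ (shift c i)     ≡⟨ cong toℕ e ⟩
               toℕ (shift d i)     ≡⟨ toℕ-shift d i ⟩
               (d + toℕ i) % k     ≡⟨ cong (_% k) (+-comm d (toℕ i)) ⟩
               (toℕ i + d) % k     ∎) ⟩
    d % k ≡⟨ m<n⇒m%n≡m d<k ⟩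
    d     ∎

  shift-reaches : ∀ i l → shift (toℕ l + (k ∸ toℕ i)) i ≡ l
  shift-reaches i l = toℕ-injective (begin
    toℕ (shift (toℕ l + (k ∸ toℕ i)) i) ≡⟨ toℕ-shift (toℕ l + (k ∸ toℕ i)) i ⟩
    (toℕ l + (k ∸ toℕ i) + toℕ i) % k   ≡⟨ cong (_% k) (+-assoc (toℕ l) (k ∸ toℕ i) (toℕ i)) ⟩
    (toℕ l + (k ∸ toℕ i + toℕ i)) % k   ≡⟨ cong (λ t → (toℕ l + t) % k) (m∸n+n≡m (<⇒≤ (toℕ<n i))) ⟩
    (toℕ l + k) % k                     ≡⟨ [m+n]%n≡m%n (toℕ l) k ⟩
    toℕ l % k                           ≡⟨ toℕ%k l ⟩
    toℕ l                               ∎)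

  consec-next : ∀ i → T (consec k i (next i))
  consec-next i with m≤n⇒m<n∨m≡n (toℕ<n i)
  ... | inj₁ 1+i<k = from T-∨ (inj₁ (≡⇒≡ᵇ (suc (toℕ i)) (toℕ (next i)) next≡))
    where
    next≡ : suc (toℕ i) ≡ toℕ (next i)
    next≡ = sym (trans (toℕ-shift 1 i) (m<n⇒m%n≡m 1+i<k))
  ... | inj₂ 1+i≡k = from T-∨ (inj₂ (from T-∧
          (≡⇒≡ᵇ (suc (toℕ i)) k 1+i≡k , ≡⇒≡ᵇ (toℕ (next i)) 0 next≡0)))
    where
    next≡0 : toℕ (next i) ≡ 0
    next≡0 = trans (toℕ-shift 1 i) (trans (cong (_% k) 1+i≡k) (n%n≡0 k))

  consec⇒next : ∀ i j → T (consec k i j) → j ≡ next i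
  consec⇒next i j t with to T-∨ t
  ... | inj₁ 1+i≡ᵇj = toℕ-injective (begin
    toℕ j                ≡⟨ 1+i≡j ⟨
    suc (toℕ i)          ≡⟨ m<n⇒m%n≡m (subst (_< k) (sym 1+i≡j) (toℕ<n j)) ⟨
    suc (toℕ i) % k      ≡⟨ toℕ-shift 1 i ⟨
    toℕ (next i)         ∎)
    where
    1+i≡j : suc (toℕ i) ≡ toℕ j
    1+i≡j = ≡ᵇ⇒≡ (suc (toℕ i)) (toℕ j) 1+i≡ᵇj
  ... | inj₂ wraps with to T-∧ wraps
  ... | 1+i≡k , j≡0 = toℕ-injective (begin
    toℕ j                ≡⟨ ≡ᵇ⇒≡ (toℕ j) 0 j≡0 ⟩
    0                    ≡⟨ n%n≡0 k ⟨
    k % k                ≡⟨ cong (_% k) (≡ᵇ⇒≡ (suc (toℕ i)) k 1+i≡k) ⟨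
    suc (toℕ i) % k      ≡⟨ toℕ-shift 1 i ⟨
    toℕ (next i)         ∎)

  cycleAdj-next : ∀ i → cycleAdj k i (next i) ≡ true
  cycleAdj-next i = to T-≡ (from T-∨ (inj₁ (consec-next i)))

  cycleAdj⇒next : ∀ i j → cycleAdj k i j ≡ true → j ≡ next i ⊎ i ≡ next j
  cycleAdj⇒next i j e with to T-∨ (from T-≡ e)
  ... | inj₁ c = inj₁ (consec⇒next i j c)
  ... | inj₂ c = inj₂ (consec⇒next j i c)

in-and-out : ∀ {b} → T b → T (not b) → ⊥
in-and-out {true} _ ()

in-or-out : ∀ {V : Set} (H : V → Bool) v → T (H v) ⊎ T (not (H v))
in-or-out H v with H v
... | true  = inj₁ _
... | false = inj₂ _

Complete Anticomplete : {V : Set} → Graph V → (V → Bool) → V → Set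
Complete     G H v = ∀ u → T (H u) → adj G v u ≡ true
Anticomplete G H v = ∀ u → T (H u) → adj G v u ≡ false

Homogeneity : {V : Set} → Graph V → (V → Bool) → Set
Homogeneity G H = ∀ v → T (not (H v)) → Complete G H v ⊎ Anticomplete G H v

same-view : ∀ {V} (G : Graph V) {H} → Homogeneity G H →
  ∀ {v u w} → T (not (H v)) → T (H u) → T (H w) → adj G v u ≡ adj G v w
same-view G hom {v} {u} {w} v∉H u∈H w∈H with hom v v∉H
... | inj₁ complete     = trans (complete u u∈H) (sym (complete w w∈H))
... | inj₂ anticomplete = trans (anticomplete u u∈H) (sym (anticomplete w w∈H))

TwoIn : {V : Set} {k : ℕ} → (V → Bool) → (Fin k → V) → Set
TwoIn H f = Σ _ λ i → Σ _ λ j → i ≢ j × T (H (f i)) × T (H (f j))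

two-in? : ∀ {V k} (H : V → Bool) (f : Fin k → V) → Dec (TwoIn H f)
two-in? H f = any? λ i → any? λ j → ¬? (i ≟ j) ×-dec T? (H (f i)) ×-dec T? (H (f j))

sub-≡ : ∀ {V} {S : V → Bool} {a b : Sub S} → proj₁ a ≡ proj₁ b → a ≡ b
sub-≡ {a = v , p} {b = .v , q} refl = cong (v ,_) (T-irrelevant p q)

lift-copy : ∀ {V} (G : Graph V) {S k P} → InducedCopy (induced G S) k P → InducedCopy G k P
lift-copy G (f , inj , ad) = (λ i → proj₁ (f i)) , (λ e → inj (sub-≡ e)) , ad

restrict-copy : ∀ {V} (G : Graph V) {S k P} (c : InducedCopy G k P) →
  (∀ i → T (S (proj₁ c i))) → InducedCopy (induced G S) k P
restrict-copy G (f , inj , ad) inS = (λ i → f i , inS i) , (λ e → inj (cong proj₁ e)) , ad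

lift-odd-hole : ∀ {V} (G : Graph V) {S} → OddHole (induced G S) → OddHole G
lift-odd-hole G (k , 4≤k , odd , c) = k , 4≤k , odd , lift-copy G c

module Collapse {n} (G : Graph (Fin n)) (H : Fin n → Bool) (hom : Homogeneity G H)
                (h : Fin n) (h∈H : T (H h)) where

  collapse : Fin n → Fin n
  collapse v = if H v then h else v

  collapse-in : ∀ {v} → T (H v) → collapse v ≡ h
  collapse-in {v} v∈H with H v
  collapse-in {v} _  | true = refl

  collapse-out : ∀ {v} → T (not (H v)) → collapse v ≡ v
  collapse-out {v} v∉H with H v
  collapse-out {v} _   | false = refl

  collapse-kept : ∀ v → T (outsidePlus H h (collapse v))
  collapse-kept v with in-or-out H v
  ... | inj₁ v∈H = subst (λ w → T (outsidePlus H h w)) (sym (collapse-in v∈H))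
                         (from T-∨ (inj₂ (fromWitness {a? = h ≟ h} refl)))
  ... | inj₂ v∉H = subst (λ w → T (outsidePlus H h w)) (sym (collapse-out v∉H))
                         (from T-∨ (inj₁ v∉H))

  collapse-adj : ∀ {u v} → ¬ (T (H u) × T (H v)) → adj G (collapse u) (collapse v) ≡ adj G u v
  collapse-adj {u} {v} notBoth with in-or-out H u | in-or-out H v
  ... | inj₁ u∈H | inj₁ v∈H = contradiction (u∈H , v∈H) notBoth
  ... | inj₁ u∈H | inj₂ v∉H = begin
    adj G (collapse u) (collapse v) ≡⟨ cong₂ (adj G) (collapse-in u∈H) (collapse-out v∉H) ⟩
    adj G h v                       ≡⟨ Graph.sym G h v ⟩
    adj G v h                       ≡⟨ same-view G hom v∉H h∈H u∈H ⟩
    adj G v u                       ≡⟨ Graph.sym G v u ⟩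
    adj G u v                       ∎
  ... | inj₂ u∉H | inj₁ v∈H = begin
    adj G (collapse u) (collapse v) ≡⟨ cong₂ (adj G) (collapse-out u∉H) (collapse-in v∈H) ⟩
    adj G u h                       ≡⟨ same-view G hom u∉H h∈H v∈H ⟩
    adj G u v                       ∎
  ... | inj₂ u∉H | inj₂ v∉H = cong₂ (adj G) (collapse-out u∉H) (collapse-out v∉H)

  outside≢h : ∀ {v} → T (not (H v)) → v ≢ h
  outside≢h v∉H refl = in-and-out h∈H v∉H

  collapse-injective : ∀ {u v} → ¬ (T (H u) × T (H v)) → collapse u ≡ collapse v → u ≡ v
  collapse-injective {u} {v} notBoth e with in-or-out H u | in-or-out H v
  ... | inj₁ u∈H | inj₁ v∈H = contradiction (u∈H , v∈H) notBoth
  ... | inj₁ u∈H | inj₂ v∉H =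
    contradiction (trans (sym (collapse-out v∉H)) (trans (sym e) (collapse-in u∈H))) (outside≢h v∉H)
  ... | inj₂ u∉H | inj₁ v∈H =
    contradiction (trans (sym (collapse-out u∉H)) (trans e (collapse-in v∈H))) (outside≢h u∉H)
  ... | inj₂ u∉H | inj₂ v∉H = trans (sym (collapse-out u∉H)) (trans e (collapse-out v∉H))

  collapse-copy : ∀ {k P} (c : InducedCopy G k P) → ¬ TwoIn H (proj₁ c) →
    InducedCopy (induced G (outsidePlus H h)) k P
  collapse-copy {k} {P} (f , inj , ad) none = g , g-injective , g-adj
    where
    g : Fin k → Sub (outsidePlus H h)
    g i = collapse (f i) , collapse-kept (f i)

    atMostOne : ∀ {i j} → i ≢ j → ¬ (T (H (f i)) × T (H (f j)))
    atMostOne {i} {j} i≢j (i∈H , j∈H) = none (i , j , i≢j , i∈H , j∈H)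

    g-injective : ∀ {i j} → g i ≡ g j → i ≡ j
    g-injective {i} {j} e with i ≟ j
    ... | yes i≡j = i≡j
    ... | no i≢j  = inj (collapse-injective (atMostOne i≢j) (cong proj₁ e))

    g-adj : ∀ i j → i ≢ j → adj G (collapse (f i)) (collapse (f j)) ≡ P i j
    g-adj i j i≢j = trans (collapse-adj (atMostOne i≢j)) (ad i j i≢j)

module LongHole {n} (G : Graph (Fin n)) (H : Fin n → Bool) (hom : Homogeneity G H)
                (K : ℕ) (4≤K : 4 ≤ K) (f : Fin (suc K) → Fin n)
                (ad : ∀ i j → i ≢ j → adj G (f i) (f j) ≡ cycleAdj (suc K) i j) where

  open Cycle K

  inH : Fin k → Set
  inH x = T (H (f x))

  apart : ∀ x {c d} → c ≤ 4 → d ≤ 4 → shift c x ≡ shift d x → c ≡ d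
  apart x c≤4 d≤4 = shift-injˡ x (s≤s (≤-trans c≤4 4≤K)) (s≤s (≤-trans d≤4 4≤K))

  edge : ∀ x → adj G (f x) (f (next x)) ≡ true
  edge x = trans (ad x (next x) x≢next) (cycleAdj-next x)
    where
    x≢next : x ≢ next x
    x≢next e = contradiction (apart x z≤n (m≤m+n 1 3) (trans (shift-zero x) e)) λ ()

  edge⇒cycleAdj : ∀ {x y} → adj G (f x) (f y) ≡ true → cycleAdj k x y ≡ true
  edge⇒cycleAdj {x} {y} e with x ≟ y
  ... | yes refl = contradiction (trans (sym e) (irrefl G (f x))) λ ()
  ... | no x≢y   = trans (sym (ad x y x≢y)) e

  neighbours : ∀ {q a} → Complete G H (f q) → inH a → a ≡ next q ⊎ q ≡ next a
  neighbours {q} {a} complete a∈H = cycleAdj⇒next q a (edge⇒cycleAdj (complete (f a) a∈H))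

  -- b, q = next b, a = next q with b, a ∈ H and q ∉ H complete to H is impossible:
  -- r = next a is neither in H (it would be a third neighbour of q) nor
  -- complete to H (r ~ b is a chord) nor anticomplete to H (r ~ a).
  no-wedge : ∀ {b q a} → q ≡ next b → a ≡ next q →
    T (not (H (f q))) → Complete G H (f q) → inH b → inH a → ⊥
  no-wedge {b} refl refl q∉H q-complete b∈H a∈H = r-case (in-or-out H (f r))
    where
    q a r : Fin k
    q = next b
    a = next q
    r = next a

    a≡ : a ≡ shift 2 b
    a≡ = next-shift 1 b
    r≡ : r ≡ shift 3 b
    r≡ = trans (cong next a≡) (next-shift 2 b)
    next-r≡ : next r ≡ shift 4 b
    next-r≡ = trans (cong next r≡) (next-shift 3 b)

    distinct : ∀ {c d} → c ≤ 4 → d ≤ 4 → shift c b ≡ shift d b → c ≢ d → ⊥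
    distinct c≤4 d≤4 e c≢d = c≢d (apart b c≤4 d≤4 e)

    r-case : inH r ⊎ T (not (H (f r))) → ⊥
    r-case (inj₁ r∈H) with neighbours q-complete r∈H
    ... | inj₁ r≡next-q =
      distinct (m≤m+n 3 1) (m≤m+n 2 2) (trans (sym r≡) (trans r≡next-q a≡)) λ ()
    ... | inj₂ q≡next-r =
      distinct (m≤m+n 1 3) ≤-refl (trans q≡next-r next-r≡) λ ()
    r-case (inj₂ r∉H) with hom (f r) r∉H
    ... | inj₂ r-anti =
      contradiction (trans (sym (r-anti (f a) a∈H)) (trans (Graph.sym G (f r) (f a)) (edge a))) λ ()
    ... | inj₁ r-complete with neighbours r-complete b∈H
    ...   | inj₁ b≡next-r =
      distinct z≤n ≤-refl (trans (shift-zero b) (trans b≡next-r next-r≡)) λ ()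
    ...   | inj₂ r≡next-b =
      distinct (m≤m+n 3 1) (m≤m+n 1 3) (trans (sym r≡) r≡next-b) λ ()

  no-exit : TwoIn H f → ∀ {q p} → T (not (H (f q))) → inH p → adj G (f q) (f p) ≡ true → ⊥
  no-exit (i , j , i≢j , i∈H , j∈H) {q} {p} q∉H p∈H qp with hom (f q) q∉H
  ... | inj₂ q-anti = contradiction (trans (sym qp) (q-anti (f p) p∈H)) λ ()
  ... | inj₁ q-complete = wedge (neighbours q-complete i∈H) (neighbours q-complete j∈H)
    where
    wedge : i ≡ next q ⊎ q ≡ next i → j ≡ next q ⊎ q ≡ next j → ⊥
    wedge (inj₁ i≡) (inj₁ j≡) = i≢j (trans i≡ (sym j≡))
    wedge (inj₂ ≡i) (inj₂ ≡j) = i≢j (shift-injʳ {1} (trans (sym ≡i) ≡j))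
    wedge (inj₁ i≡) (inj₂ ≡j) = no-wedge ≡j i≡ q∉H q-complete j∈H i∈H
    wedge (inj₂ ≡i) (inj₁ j≡) = no-wedge ≡i j≡ q∉H q-complete i∈H j∈H

  next-inH : TwoIn H f → ∀ x → inH x → inH (next x)
  next-inH two x x∈H with H (f (next x)) in eq
  ... | true  = _
  ... | false = no-exit two (from T-not-≡ eq) x∈H (trans (Graph.sym G (f (next x)) (f x)) (edge x))

  all-inH : TwoIn H f → ∀ l → inH l
  all-inH two@(i , _ , _ , i∈H , _) l = subst inH (shift-reaches i l) (around (toℕ l + (k ∸ toℕ i)))
    where
    around : ∀ t → inH (shift t i)
    around zero    = subst inH (sym (shift-zero i)) i∈H
    around (suc t) = subst inH (next-shift t i) (next-inH two (shift t i) (around t))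

odd-hole-long : ∀ {k} → 4 ≤ k → Odd k → 5 ≤ k
odd-hole-long (s≤s ())             (zero , refl)
odd-hole-long (s≤s (s≤s (s≤s ()))) (suc zero , refl)
odd-hole-long _                    (suc (suc m) , refl) =
  s≤s (s≤s (s≤s (≤-trans (s≤s (s≤s z≤n)) (m≤n+m (suc (suc (m + 0))) m))))

hole-inside : ∀ {n} (G : Graph (Fin n)) (H : Fin n → Bool) → Homogeneity G H →
  ∀ {k} → 5 ≤ k → (c : InducedCopy G k (cycleAdj k)) → TwoIn H (proj₁ c) →
  ∀ l → T (H (proj₁ c l))
hole-inside G H hom {suc K} (s≤s 4≤K) (f , _ , ad) = LongHole.all-inH G H hom K 4≤K f ad

odd-hole-free-from-parts : ∀ {n} (G : Graph (Fin n)) (H : Fin n → Bool) → Homogeneity G H →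
  ∀ h → T (H h) → ¬ OddHole (induced G H) → ¬ OddHole (induced G (outsidePlus H h)) →
  ¬ OddHole G
odd-hole-free-from-parts G H hom h h∈H no-hole-in no-hole-out (k , 4≤k , odd , c)
  with two-in? H (proj₁ c)
... | yes two = no-hole-in (k , 4≤k , odd ,
        restrict-copy G c (hole-inside G H hom (odd-hole-long 4≤k odd) c two))
... | no none = no-hole-out (k , 4≤k , odd , Collapse.collapse-copy G H hom h h∈H c none)

-- Odd holes of induced subgraphs are odd holes of G; the converse is the
-- decomposition above.
mainTheorem4 : (n : ℕ) (G : Graph (Fin n)) (H : Fin n → Bool) →
    BannerFree G → Homogeneous G H → (h : Fin n) → T (H h) →
    (¬ OddHole G) ⇔ ((¬ OddHole (induced G H)) × (¬ OddHole (induced G (outsidePlus H h))))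
mainTheorem4 n G H _ (_ , _ , hom) h h∈H = mk⇔
  (λ no-hole → (λ hole → no-hole (lift-odd-hole G hole)) , (λ hole → no-hole (lift-odd-hole G hole)))
  (λ (no-hole-in , no-hole-out) → odd-hole-free-from-parts G H hom h h∈H no-hole-in no-hole-out)
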